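{- Let $Y$ be a Bernoulli random variable with probability of success $p$. For all integers $n\ge 0$ (and $0\le k\le n$), $$H_{n,\lambda}^{Y}(x)=H_{n,\lambda}(xp),\qquad H_{\lambda}^{Y}(n,k)=p^{k}H_{\lambda}(n,k).$$
   Context: Fix a nonzero real $\lambda$. Put $\langle x\rangle_{0,\lambda}=1$, $\langle x\rangle_{n,\lambda}=x(x+\lambda)\cdots(x+(n-1)\lambda)$, and for real $a$ let $e_\lambda^{ -a}(-t)=(1-\lambda t)^{ -a/\lambda}=\sum_{n\ge0}\langle a\rangle_{n,\lambda}t^n/n!$. The probabilistic heterogeneous Stirling numbers of the second kind associated with $Y$ are defined by $\frac{1}{k!}(E[e_{\lambda}^{ -Y}(-t)]-1)^{k}=\sum_{n\ge k}H_{\lambda}^{Y}(n,k)t^{n}/n!$, and the probabilistic heterogeneous Bell polynomials by $e^{x(E[e_{\lambda}^{ -Y}(-t)]-1)}=\sum_{n\ge0}H_{n,\lambda}^{Y}(x)t^{n}/n!$. The heterogeneous Stirling numbers of the second kind $H_\lambda(n,k)$ are defined by $\frac{1}{k!}(e_{\lambda}^{ -1}(-t)-1)^{k}=\sum_{n\ge k}H_{\lambda}(n,k)\frac{t^{n}}{n!}$, and the heterogeneous Bell polynomials by $e^{x(e_{\lambda}^{ -1}(-t)-1)}=\sum_{n\ge0}H_{n,\lambda}(x)\frac{t^{n}}{n!}$. -}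

module Defs where

open import Level using (_⊔_)
open import Data.Nat using (ℕ; zero; suc; _∸_)
open import Algebra.Bundles using (CommutativeRing)

natCast : ∀ {c ℓ} (R : CommutativeRing c ℓ) → ℕ → CommutativeRing.Carrier R
natCast R zero    = CommutativeRing.0# R
natCast R (suc n) = CommutativeRing._+_ R (CommutativeRing.1# R) (natCast R n)

-- A commutative ring in which every positive integer is invertible
-- (i.e. a commutative Q-algebra).  The real numbers are an instance.
record QAlgebra (c ℓ : Level.Level) : Set (Level.suc (c ⊔ ℓ)) where
  field
    cring : CommutativeRing c ℓ
  open CommutativeRing cring
  field
    inv      : ℕ → Carrier                       -- inv n = 1 / (n+1)
    inv-spec : ∀ n → natCast cring (suc n) * inv n ≈ 1#

module Ops {c ℓ} (A : QAlgebra c ℓ) where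
  open QAlgebra A using (cring; inv; inv-spec) public
  open CommutativeRing cring public

  natCastA : ℕ → Carrier
  natCastA = natCast cring

  sumTo : ℕ → (ℕ → Carrier) → Carrier
  sumTo zero    f = f 0
  sumTo (suc n) f = sumTo n f + f (suc n)

  fact : ℕ → Carrier
  fact zero    = 1#
  fact (suc n) = natCastA (suc n) * fact n

  invFact : ℕ → Carrier
  invFact zero    = 1#
  invFact (suc n) = inv n * invFact n

  _^_ : Carrier → ℕ → Carrier
  a ^ zero  = 1#
  a ^ suc n = a * (a ^ n)

  lamFact : Carrier → Carrier → ℕ → Carrier
  lamFact lam x zero    = 1#
  lamFact lam x (suc n) = lamFact lam x n * (x + natCastA n * lam)

  -- formal power series in t : coefficient of t^n
  Series : Set c
  Series = ℕ → Carrier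

  constS : Carrier → Series
  constS a zero    = a
  constS a (suc n) = 0#

  _⊕_ : Series → Series → Series
  (f ⊕ g) n = f n + g n

  _⊖_ : Series → Series → Series
  (f ⊖ g) n = f n - g n

  scaleS : Carrier → Series → Series
  scaleS a f n = a * f n

  _⊛_ : Series → Series → Series
  (f ⊛ g) n = sumTo n (λ i → f i * g (n ∸ i))

  powS : Series → ℕ → Series
  powS f zero    = constS 1#
  powS f (suc k) = f ⊛ powS f k

  -- exp(g) = Σ_k g^k / k!  for a series g with zero constant term
  -- (coefficient of t^n only involves k ≤ n)
  expS : Series → Series
  expS g n = sumTo n (λ k → invFact k * powS g k n)

  -- e_λ^{-a}(-t) = (1 - λ t)^{-a/λ} = Σ_n <a>_{n,λ} t^n / n!
  eLam : Carrier → Carrier → Series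
  eLam lam a n = lamFact lam a n * invFact n

  egfCoeff : Series → ℕ → Carrier
  egfCoeff f n = fact n * f n

  -- Expectation of a function of a Bernoulli(p) random variable Y:
  -- E[g(Y)] = (1-p) g(0) + p g(1), applied coefficientwise to series.
  EBern : Carrier → (Carrier → Series) → Series
  EBern p g n = (1# - p) * g 0# n + p * g 1# n

  mgfBern : Carrier → Carrier → Series
  mgfBern lam p = EBern p (λ y → eLam lam y)

  HY : Carrier → Carrier → ℕ → ℕ → Carrier
  HY lam p n k = egfCoeff (scaleS (invFact k) (powS (mgfBern lam p ⊖ constS 1#) k)) n

  HYBell : Carrier → Carrier → ℕ → Carrier → Carrier
  HYBell lam p n x = egfCoeff (expS (scaleS x (mgfBern lam p ⊖ constS 1#))) n

  H : Carrier → ℕ → ℕ → Carrier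
  H lam n k = egfCoeff (scaleS (invFact k) (powS (eLam lam 1# ⊖ constS 1#) k)) n

  HBell : Carrier → ℕ → Carrier → Carrier
  HBell lam n x = egfCoeff (expS (scaleS x (eLam lam 1# ⊖ constS 1#))) n

{-# OPTIONS --safe #-}
module Submission where

-- Since Y takes only the values 0 and 1 and e_λ^0(-t) = 1, the series
-- E[e_λ^{-Y}(-t)] - 1 = (1 - p) + p e_λ^{-1}(-t) - 1 is p (e_λ^{-1}(-t) - 1).
-- Substituting this into the generating functions, the k-th power picks up
-- the factor p^k and exp(x p (e_λ^{-1}(-t) - 1)) is the Bell series at x p.

open import Defs
open import Data.Nat using (ℕ; _≤_; zero; suc; _∸_)
open import Data.Product using (_×_; _,_)
open import Data.Maybe using (nothing)
open import Tactic.RingSolver.Core.AlmostCommutativeRing using (fromCommutativeRing)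
import Tactic.RingSolver.NonReflective as Solver
import Algebra.Properties.Ring as RingProperties

module SeriesProperties {c ℓ} (A : QAlgebra c ℓ) where
  open Ops A
  open Solver (fromCommutativeRing cring (λ _ → nothing))
    using (solve; _⊜_) renaming (_⊕_ to _:+_; _⊗_ to _:*_; ⊝_ to :-_)
  open RingProperties ring using ([y-z]x≈yx-zx; x[y-z]≈xy-xz)
  open import Relation.Binary.Reasoning.Setoid setoid

  infix 4 _≋_
  _≋_ : Series → Series → Set ℓ
  f ≋ g = ∀ n → f n ≈ g n

  sumTo-cong : ∀ n {f g : ℕ → Carrier} → (∀ i → f i ≈ g i) → sumTo n f ≈ sumTo n g
  sumTo-cong zero    f≈g = f≈g 0
  sumTo-cong (suc n) f≈g = +-cong (sumTo-cong n f≈g) (f≈g (suc n))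

  *-distribˡ-sumTo : ∀ a n (f : ℕ → Carrier) → a * sumTo n f ≈ sumTo n (λ i → a * f i)
  *-distribˡ-sumTo a zero    f = refl
  *-distribˡ-sumTo a (suc n) f = trans (distribˡ a _ _) (+-congʳ (*-distribˡ-sumTo a n f))

  powS-cong : ∀ {f g} → f ≋ g → ∀ k → powS f k ≋ powS g k
  powS-cong f≋g zero    n = refl
  powS-cong f≋g (suc k) n = sumTo-cong n (λ i → *-cong (f≋g i) (powS-cong f≋g k (n ∸ i)))

  expS-cong : ∀ {f g} → f ≋ g → expS f ≋ expS g
  expS-cong f≋g n = sumTo-cong n (λ k → *-congˡ (powS-cong f≋g k n))

  scaleS-assoc : ∀ a b f → scaleS a (scaleS b f) ≋ scaleS (a * b) f
  scaleS-assoc a b f n = sym (*-assoc a b (f n))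

  egfCoeff-scaleS-comm : ∀ u v f n → egfCoeff (scaleS u (scaleS v f)) n ≈ v * egfCoeff (scaleS u f) n
  egfCoeff-scaleS-comm u v f n = pull-out (fact n) u v (f n)
    where
    pull-out : ∀ w x y z → w * (x * (y * z)) ≈ y * (w * (x * z))
    pull-out = solve 4 (λ w x y z → (w :* (x :* (y :* z))) ⊜ (y :* (w :* (x :* z)))) refl

  powS-scaleS : ∀ a f k → powS (scaleS a f) k ≋ scaleS (a ^ k) (powS f k)
  powS-scaleS a f zero    n = sym (*-identityˡ _)
  powS-scaleS a f (suc k) n = begin
    sumTo n (λ i → a * f i * powS (scaleS a f) k (n ∸ i))
      ≈⟨ sumTo-cong n (λ i → *-congˡ (powS-scaleS a f k (n ∸ i))) ⟩
    sumTo n (λ i → a * f i * (a ^ k * powS f k (n ∸ i)))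
      ≈⟨ sumTo-cong n (λ i → interchange a (f i) (a ^ k) _) ⟩
    sumTo n (λ i → a * a ^ k * (f i * powS f k (n ∸ i)))
      ≈⟨ *-distribˡ-sumTo (a * a ^ k) n _ ⟨
    a * a ^ k * sumTo n (λ i → f i * powS f k (n ∸ i)) ∎
    where
    interchange : ∀ u x v y → u * x * (v * y) ≈ u * v * (x * y)
    interchange = solve 4 (λ u x v y → (u :* x) :* (v :* y) ⊜ (u :* v) :* (x :* y)) refl

  lamFact-zero : ∀ lam n → lamFact lam 0# (suc n) ≈ 0#
  lamFact-zero lam zero    = trans (*-identityˡ _) (trans (+-identityˡ _) (zeroˡ lam))
  lamFact-zero lam (suc n) = trans (*-congʳ (lamFact-zero lam n)) (zeroˡ _)

  eLam-zero : ∀ lam → eLam lam 0# ≋ constS 1#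
  eLam-zero lam zero    = *-identityˡ _
  eLam-zero lam (suc n) = trans (*-congʳ (lamFact-zero lam n)) (zeroˡ _)

  EBern-⊖ : ∀ p (g : Carrier → Series) → EBern p g ⊖ g 0# ≋ scaleS p (g 1# ⊖ g 0#)
  EBern-⊖ p g n = begin
    (1# - p) * b + p * a - b        ≈⟨ +-congʳ (+-congʳ ([y-z]x≈yx-zx b 1# p)) ⟩
    1# * b - p * b + p * a - b      ≈⟨ +-congʳ (+-congʳ (+-congʳ (*-identityˡ b))) ⟩
    b - p * b + p * a - b           ≈⟨ regroup b (- (p * b)) (p * a) (- b) ⟩
    (b - b) + (p * a - p * b)       ≈⟨ +-congʳ (-‿inverseʳ b) ⟩
    0# + (p * a - p * b)            ≈⟨ +-identityˡ _ ⟩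
    p * a - p * b                   ≈⟨ x[y-z]≈xy-xz p a b ⟨
    p * (a - b)                     ∎
    where
    a b : Carrier
    a = g 1# n
    b = g 0# n
    regroup : ∀ x y z w → x + y + z + w ≈ (x + w) + (z + y)
    regroup = solve 4 (λ x y z w → (x :+ y :+ z :+ w) ⊜ ((x :+ w) :+ (z :+ y))) refl

  mgfBern-⊖-one : ∀ lam p → mgfBern lam p ⊖ constS 1# ≋ scaleS p (eLam lam 1# ⊖ constS 1#)
  mgfBern-⊖-one lam p n = begin
    mgfBern lam p n - constS 1# n
      ≈⟨ +-congˡ (-‿cong (eLam-zero lam n)) ⟨
    mgfBern lam p n - eLam lam 0# n
      ≈⟨ EBern-⊖ p (eLam lam) n ⟩
    p * (eLam lam 1# n - eLam lam 0# n)
      ≈⟨ *-congˡ (+-congˡ (-‿cong (eLam-zero lam n))) ⟩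
    p * (eLam lam 1# n - constS 1# n) ∎

theorem2p18 : ∀ {c ℓ} (A : QAlgebra c ℓ) →
    let open Ops A in
    ∀ (lam p x : Carrier) → (n k : ℕ) → k ≤ n →
      (HYBell lam p n x ≈ HBell lam n (x * p)) × (HY lam p n k ≈ (p ^ k) * H lam n k)
theorem2p18 A lam p x n k _ = bell , stirling
  where
  open Ops A
  open SeriesProperties A

  g : Series
  g = eLam lam 1# ⊖ constS 1#

  bell : HYBell lam p n x ≈ HBell lam n (x * p)
  bell = *-congˡ (expS-cong (λ i → trans (*-congˡ (mgfBern-⊖-one lam p i)) (scaleS-assoc x p g i)) n)

  stirling : HY lam p n k ≈ (p ^ k) * H lam n k
  stirling = trans (*-congˡ (*-congˡ (trans (powS-cong (mgfBern-⊖-one lam p) k n) (powS-scaleS p g k n))))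
                   (egfCoeff-scaleS-comm (invFact k) (p ^ k) (powS g k) n)
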